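{- Let $\lambda\subseteq\mu$ be partitions. Let $\overline{\mathrm{SSYT}}^{\lambda_1}(\mu/\lambda)$ be the set of semistandard Young tableaux of shape $\mu/\lambda$ all of whose entries in the $j$-th row lie in $[\lambda_1+1-\lambda_j,\lambda_1]$ for every $j$. Define $\phi$ on $\mathcal F^c_{\mu/\lambda}$ by subtracting $c-\lambda_1-1$ from (i.e. adding $\lambda_1+1-c$ to) each entry in column $c$. Then $\phi\colon\mathcal F^c_{\mu/\lambda}\to\overline{\mathrm{SSYT}}^{\lambda_1}(\mu/\lambda)$ is a bijection.
   Context: $\mathcal F^c_{\mu/\lambda}$ is the set of increasing tableaux of shape $\mu/\lambda$ (fillings of the boxes of $\mu$ not in $\lambda$, English convention, by positive integers strictly increasing along rows and strictly increasing down columns) such that every entry in column $c$ is strictly less than $c$. A semistandard Young tableau of shape $\mu/\lambda$ is a filling of the same boxes by positive integers weakly increasing along rows and strictly increasing down columns. $\lambda_j=0$ for $j>\ell(\lambda)$. -}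

module Defs where

open import Data.Nat using (ℕ; zero; suc; _+_; _∸_; _≤_; _<_)
open import Data.List using (List; []; _∷_; length)
open import Data.List.Relation.Unary.All using (All)
open import Data.List.Relation.Unary.Linked using (Linked)
open import Data.Product using (_×_)
open import Relation.Binary.PropositionalEquality using (_≡_)

nth : {A : Set} → List A → A → ℕ → A
nth []       d _       = d
nth (x ∷ xs) d zero    = x
nth (x ∷ xs) d (suc n) = nth xs d n

-- λ_j, 1-indexed, with λ_j = 0 for j > ℓ(λ)
part : List ℕ → ℕ → ℕ
part la j = nth la 0 (j ∸ 1)

IsPartition : List ℕ → Set
IsPartition la = All (λ x → 1 ≤ x) la × Linked (λ x y → y ≤ x) la

_⊆ₚ_ : List ℕ → List ℕ → Set
la ⊆ₚ mu = ∀ j → part la j ≤ part mu j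

-- A filling of μ/λ is stored as a list of rows: row j (1-indexed) is the list
-- of entries in the boxes (j,c), λ_j < c ≤ μ_j, from left to right.
Filling : Set
Filling = List (List ℕ)

-- (j,c) is a box of μ/λ (row j, column c, both 1-indexed, English convention)
InShape : List ℕ → List ℕ → ℕ → ℕ → Set
InShape mu la j c = (1 ≤ j) × (part la j < c) × (c ≤ part mu j)

HasShape : List ℕ → List ℕ → Filling → Set
HasShape mu la T =
  (length T ≡ length mu) ×
  (∀ j → 1 ≤ j → j ≤ length mu → length (nth T [] (j ∸ 1)) ≡ (part mu j ∸ part la j))

entry : List ℕ → Filling → ℕ → ℕ → ℕ
entry la T j c = nth (nth T [] (j ∸ 1)) 0 (c ∸ part la j ∸ 1)

IsIncreasingTableau : List ℕ → List ℕ → Filling → Set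
IsIncreasingTableau mu la T =
  HasShape mu la T ×
  (∀ j c → InShape mu la j c → 1 ≤ entry la T j c) ×
  (∀ j c c' → InShape mu la j c → InShape mu la j c' → c < c' →
     entry la T j c < entry la T j c') ×
  (∀ j j' c → InShape mu la j c → InShape mu la j' c → j < j' →
     entry la T j c < entry la T j' c)

Fc : List ℕ → List ℕ → Filling → Set
Fc mu la T =
  IsIncreasingTableau mu la T ×
  (∀ j c → InShape mu la j c → entry la T j c < c)

IsSSYT : List ℕ → List ℕ → Filling → Set
IsSSYT mu la T =
  HasShape mu la T ×
  (∀ j c → InShape mu la j c → 1 ≤ entry la T j c) ×
  (∀ j c c' → InShape mu la j c → InShape mu la j c' → c < c' →
     entry la T j c ≤ entry la T j c') ×
  (∀ j j' c → InShape mu la j c → InShape mu la j' c → j < j' →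
     entry la T j c < entry la T j' c)

SSYTbar : List ℕ → List ℕ → Filling → Set
SSYTbar mu la T =
  IsSSYT mu la T ×
  (∀ j c → InShape mu la j c →
     (part la 1 + 1 ∸ part la j ≤ entry la T j c) × (entry la T j c ≤ part la 1))

-- φ: add λ₁+1-c to each entry in column c.
-- Row with 1-indexed number j; its k-th entry (0-indexed) sits in column λ_j + k + 1.
phiRow : ℕ → ℕ → List ℕ → List ℕ
phiRow l1 c []       = []
phiRow l1 c (e ∷ es) = (e + l1 + 1 ∸ c) ∷ phiRow l1 (suc c) es

phiRows : List ℕ → ℕ → Filling → Filling
phiRows la j []       = []
phiRows la j (r ∷ rs) = phiRow (part la 1) (part la j + 1) r ∷ phiRows la (suc j) rs

phi : List ℕ → Filling → Filling
phi la T = phiRows la 1 T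

-- Write K = λ₁. φ sends an entry e in column c to s = e + K + 1 − c, an entrywise bijection
-- with inverse s ↦ s + c − K − 1. It preserves strict increase down a column, and turns strict
-- increase along a row, which for integers means e' − e ≥ c' − c, into weak increase. The bound
-- e < c becomes s ≤ K. In row j a positive strictly increasing row starting in column λ_j + 1
-- has e ≥ c − λ_j, which becomes s ≥ K + 1 − λ_j; conversely that bound and c > λ_j make the
-- preimage of s positive.
module Submission where

open import Defs
import Algebra.Properties.CommutativeSemigroup as CommSemigroupProperties
open import Data.List using (List; []; _∷_; length)
open import Data.List.Relation.Unary.All using (All; _∷_)
open import Data.List.Relation.Unary.Linked.Properties using (Linked⇒All)
open import Data.Nat using (ℕ; zero; suc; _+_; _∸_; _≤_; _<_; z≤n; s≤s; s≤s⁻¹; z<s; _≤′_; ≤′-refl; ≤′-step)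
open import Data.Nat.Properties
open import Data.Product using (_×_; ∃; _,_; proj₁; proj₂)
open import Function using (flip)
open import Relation.Binary.PropositionalEquality

open CommSemigroupProperties +-commutativeSemigroup using (xy∙z≈xz∙y; x∙yz≈y∙xz)

nth-ext : {A : Set} (d : A) (xs ys : List A) → length xs ≡ length ys →
          (∀ k → k < length xs → nth xs d k ≡ nth ys d k) → xs ≡ ys
nth-ext d []       []       _  _  = refl
nth-ext d (x ∷ xs) (y ∷ ys) eq eqₖ =
  cong₂ _∷_ (eqₖ 0 z<s) (nth-ext d xs ys (suc-injective eq) (λ k k< → eqₖ (suc k) (s≤s k<)))

0<nth⇒<length : ∀ xs i → 0 < nth xs 0 i → i < length xs
0<nth⇒<length (x ∷ xs) zero    _ = z<s
0<nth⇒<length (x ∷ xs) (suc i) p = s≤s (0<nth⇒<length xs i p)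

nth-All : {A : Set} {P : A → Set} {d : A} {xs : List A} → All P xs → P d → ∀ i → P (nth xs d i)
nth-All All.[]     pd _       = pd
nth-All (px ∷ _)   _  zero    = px
nth-All (_ ∷ pxs)  pd (suc i) = nth-All pxs pd i

part≤part₁ : ∀ {la} → IsPartition la → ∀ j → part la j ≤ part la 1
part≤part₁ {[]}     _                j = z≤n
part≤part₁ {x ∷ xs} (_ , decreasing) j =
  nth-All (Linked⇒All (flip ≤-trans) ≤-refl decreasing) z≤n (j ∸ 1)

+-suc-∸-∸1 : ∀ {l c} → l < c → l + suc (c ∸ l ∸ 1) ≡ c
+-suc-∸-∸1 {zero}  {suc c} _       = refl
+-suc-∸-∸1 {suc l} {suc c} (s≤s p) = cong suc (+-suc-∸-∸1 p)

module _ (f : ℕ → ℕ) {lo hi : ℕ}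
         (f-increasing : ∀ {c c'} → lo < c → c < c' → c' ≤ hi → f c < f c') where

  increasing-gap : ∀ {c c'} → lo < c → c ≤′ c' → c' ≤ hi → f c + c' ≤ f c' + c
  increasing-gap _ ≤′-refl _ = ≤-refl
  increasing-gap {c} lo<c (≤′-step {n} c≤′n) 1+n≤hi = begin
    f c + suc n    ≡⟨ +-suc (f c) n ⟩
    suc (f c + n)  ≤⟨ s≤s (increasing-gap lo<c c≤′n (≤-trans (n≤1+n n) 1+n≤hi)) ⟩
    suc (f n + c)  ≤⟨ +-monoˡ-≤ c (f-increasing (<-≤-trans lo<c (≤′⇒≤ c≤′n)) (n<1+n n) 1+n≤hi) ⟩
    f (suc n) + c  ∎
    where open ≤-Reasoning

  increasing-lowerBound : (∀ {c} → lo < c → c ≤ hi → 1 ≤ f c) →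
                          ∀ {c} → lo < c → c ≤ hi → c ≤ f c + lo
  increasing-lowerBound f-positive {c} lo<c c≤hi = s≤s⁻¹ (begin
    suc c               ≤⟨ +-monoˡ-≤ c (f-positive ≤-refl (≤-trans lo<c c≤hi)) ⟩
    f (suc lo) + c      ≤⟨ increasing-gap ≤-refl (≤⇒≤′ lo<c) c≤hi ⟩
    f c + suc lo        ≡⟨ +-suc (f c) lo ⟩
    suc (f c + lo)      ∎)
    where open ≤-Reasoning

phiEntry : ℕ → ℕ → ℕ → ℕ
phiEntry K c e = e + K + 1 ∸ c

psiEntry : ℕ → ℕ → ℕ → ℕ
psiEntry K c s = s + c ∸ suc K

-- s = e + K + 1 − c without truncated subtraction; φ and its inverse both produce it.
record Shift (K c e s : ℕ) : Set where
  constructor shift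
  field
    sum-eq : s + c ≡ e + suc K

module _ {K : ℕ} where

  +1≡+suc : ∀ e → e + K + 1 ≡ e + suc K
  +1≡+suc e = trans (+-assoc e K 1) (cong (e +_) (+-comm K 1))

  shift-phiEntry : ∀ {c e} → c ≤ e + suc K → Shift K c e (phiEntry K c e)
  shift-phiEntry {c} {e} c≤ = shift (trans (m∸n+n≡m (subst (c ≤_) (sym (+1≡+suc e)) c≤)) (+1≡+suc e))

  phiEntry-shift : ∀ {c e s} → Shift K c e s → phiEntry K c e ≡ s
  phiEntry-shift {c} {e} {s} (shift eq) = begin
    e + K + 1 ∸ c  ≡⟨ cong (_∸ c) (trans (+1≡+suc e) (sym eq)) ⟩
    s + c ∸ c      ≡⟨ m+n∸n≡m s c ⟩
    s              ∎
    where open ≡-Reasoning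

  shift-psiEntry : ∀ {c s} → suc K ≤ s + c → Shift K c (psiEntry K c s) s
  shift-psiEntry K<s+c = shift (sym (m∸n+n≡m K<s+c))

  shift-injective : ∀ {c e e' s} → Shift K c e s → Shift K c e' s → e ≡ e'
  shift-injective {e = e} {e'} (shift eq) (shift eq') = +-cancelʳ-≡ (suc K) e e' (trans (sym eq) eq')

  shift-reflects-< : ∀ {c c' e e' s s'} → Shift K c e s → Shift K c' e' s' →
                     s + c < s' + c' → e < e'
  shift-reflects-< {e = e} {e'} (shift eq) (shift eq') lt =
    +-cancelʳ-< (suc K) e e' (subst₂ _<_ eq eq' lt)

  shift-preserves-< : ∀ {c c' e e' s s'} → Shift K c e s → Shift K c' e' s' →
                      e < e' → s + c < s' + c'
  shift-preserves-< (shift eq) (shift eq') lt = subst₂ _<_ (sym eq) (sym eq') (+-monoˡ-< (suc K) lt)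

  shift-monotone : ∀ {c c' e e' s s'} → Shift K c e s → Shift K c' e' s' →
                   e + c' ≤ e' + c → s ≤ s'
  shift-monotone {c} {c'} {e} {e'} {s} {s'} (shift eq) (shift eq') le =
    +-cancelʳ-≤ c s s' (+-cancelʳ-≤ c' (s + c) (s' + c) (begin
      s + c + c'       ≡⟨ cong (_+ c') eq ⟩
      e + suc K + c'   ≡⟨ xy∙z≈xz∙y e (suc K) c' ⟩
      e + c' + suc K   ≤⟨ +-monoˡ-≤ (suc K) le ⟩
      e' + c + suc K   ≡⟨ xy∙z≈xz∙y e' c (suc K) ⟩
      e' + suc K + c   ≡⟨ cong (_+ c) (sym eq') ⟩
      s' + c' + c      ≡⟨ xy∙z≈xz∙y s' c' c ⟩
      s' + c + c'      ∎))
    where open ≤-Reasoning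

  shift-<c⇒≤K : ∀ {c e s} → Shift K c e s → e < c → s ≤ K
  shift-<c⇒≤K {c} {e} {s} (shift eq) e<c = +-cancelʳ-≤ c s K (begin
    s + c          ≡⟨ eq ⟩
    e + suc K      ≡⟨ +-suc e K ⟩
    suc e + K      ≤⟨ +-monoˡ-≤ K e<c ⟩
    c + K          ≡⟨ +-comm c K ⟩
    K + c          ∎)
    where open ≤-Reasoning

  shift-≤K⇒<c : ∀ {c e s} → Shift K c e s → s ≤ K → e < c
  shift-≤K⇒<c {c} {e} {s} (shift eq) s≤K = +-cancelʳ-≤ K (suc e) c (begin
    suc e + K      ≡⟨ sym (+-suc e K) ⟩
    e + suc K      ≡⟨ sym eq ⟩
    s + c          ≤⟨ +-monoˡ-≤ c s≤K ⟩
    K + c          ≡⟨ +-comm K c ⟩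
    c + K          ∎)
    where open ≤-Reasoning

  shift-lowerBound : ∀ {c e s l} → Shift K c e s → c ≤ e + l → K + 1 ∸ l ≤ s
  shift-lowerBound {c} {e} {s} {l} (shift eq) c≤e+l =
    m≤n+o⇒m∸n≤o (K + 1) l (subst₂ _≤_ (+-comm 1 K) (+-comm s l) K<s+l)
    where
    K<s+l : suc K ≤ s + l
    K<s+l = +-cancelˡ-≤ e (suc K) (s + l) (begin
      e + suc K      ≡⟨ sym eq ⟩
      s + c          ≤⟨ +-monoʳ-≤ s c≤e+l ⟩
      s + (e + l)    ≡⟨ x∙yz≈y∙xz s e l ⟩
      e + (s + l)    ∎)
      where open ≤-Reasoning

  shift-positive : ∀ {c e s} → Shift K c e s → suc K < s + c → 1 ≤ e
  shift-positive {e = e} (shift eq) K<s+c = +-cancelʳ-< (suc K) 0 e (subst (suc K <_) eq K<s+c)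

mapRow : (ℕ → ℕ → ℕ) → ℕ → List ℕ → List ℕ
mapRow f c []       = []
mapRow f c (e ∷ es) = f c e ∷ mapRow f (suc c) es

mapRows : (ℕ → ℕ → ℕ) → List ℕ → ℕ → Filling → Filling
mapRows f la j []       = []
mapRows f la j (r ∷ rs) = mapRow f (part la j + 1) r ∷ mapRows f la (suc j) rs

mapFilling : (ℕ → ℕ → ℕ) → List ℕ → Filling → Filling
mapFilling f la = mapRows f la 1

phiRow≡mapRow : ∀ K c r → phiRow K c r ≡ mapRow (phiEntry K) c r
phiRow≡mapRow K c []      = refl
phiRow≡mapRow K c (e ∷ r) = cong (_ ∷_) (phiRow≡mapRow K (suc c) r)

phiRows≡mapRows : ∀ la j T → phiRows la j T ≡ mapRows (phiEntry (part la 1)) la j T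
phiRows≡mapRows la j []      = refl
phiRows≡mapRows la j (r ∷ T) = cong₂ _∷_ (phiRow≡mapRow _ _ r) (phiRows≡mapRows la (suc j) T)

phi≡mapFilling : ∀ la T → phi la T ≡ mapFilling (phiEntry (part la 1)) la T
phi≡mapFilling la = phiRows≡mapRows la 1

psi : List ℕ → Filling → Filling
psi la = mapFilling (psiEntry (part la 1)) la

length-mapRow : ∀ f c r → length (mapRow f c r) ≡ length r
length-mapRow f c []      = refl
length-mapRow f c (e ∷ r) = cong suc (length-mapRow f (suc c) r)

length-mapRows : ∀ f la j T → length (mapRows f la j T) ≡ length T
length-mapRows f la j []      = refl
length-mapRows f la j (r ∷ T) = cong suc (length-mapRows f la (suc j) T)

nth-mapRow : ∀ f c r {k} → k < length r → nth (mapRow f c r) 0 k ≡ f (c + k) (nth r 0 k)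
nth-mapRow f c (e ∷ r) {zero}  _       = cong (λ c' → f c' e) (sym (+-identityʳ c))
nth-mapRow f c (e ∷ r) {suc k} (s≤s p) =
  trans (nth-mapRow f (suc c) r p) (cong (λ c' → f c' (nth r 0 k)) (sym (+-suc c k)))

nth-mapRows : ∀ f la j T i →
              nth (mapRows f la j T) [] i ≡ mapRow f (part la (j + i) + 1) (nth T [] i)
nth-mapRows f la j []      i       = refl
nth-mapRows f la j (r ∷ T) zero    = cong (λ j' → mapRow f (part la j' + 1) r) (sym (+-identityʳ j))
nth-mapRows f la j (r ∷ T) (suc i) =
  trans (nth-mapRows f la (suc j) T i)
        (cong (λ j' → mapRow f (part la j' + 1) (nth T [] i)) (sym (+-suc j i)))

module SkewShape (mu la : List ℕ) where

  HasShape-mapFilling : ∀ f T → HasShape mu la T → HasShape mu la (mapFilling f la T)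
  HasShape-mapFilling f T (lengthT , rowLength) =
    trans (length-mapRows f la 1 T) lengthT , rowLength'
    where
    rowLength' : ∀ j → 1 ≤ j → j ≤ length mu →
                 length (nth (mapFilling f la T) [] (j ∸ 1)) ≡ part mu j ∸ part la j
    rowLength' (suc i) 1≤j j≤ = begin
      length (nth (mapFilling f la T) [] i)              ≡⟨ cong length (nth-mapRows f la 1 T i) ⟩
      length (mapRow f (part la (suc i) + 1) (nth T [] i)) ≡⟨ length-mapRow f _ (nth T [] i) ⟩
      length (nth T [] i)                                ≡⟨ rowLength (suc i) 1≤j j≤ ⟩
      part mu (suc i) ∸ part la (suc i)                  ∎
      where open ≡-Reasoning

  entry-mapFilling : ∀ f T {j c} → HasShape mu la T → InShape mu la j c →
                     entry la (mapFilling f la T) j c ≡ f c (entry la T j c)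
  entry-mapFilling f T {suc i} {c} (_ , rowLength) (1≤j , l<c , c≤m) = begin
    nth (nth (mapFilling f la T) [] i) 0 k  ≡⟨ cong (λ r → nth r 0 k) (nth-mapRows f la 1 T i) ⟩
    nth (mapRow f (l + 1) row) 0 k          ≡⟨ nth-mapRow f (l + 1) row k<length ⟩
    f (l + 1 + k) (nth row 0 k)             ≡⟨ cong (λ c' → f c' (nth row 0 k)) column ⟩
    f c (nth row 0 k)                       ∎
    where
    open ≡-Reasoning
    l = part la (suc i)
    k = c ∸ l ∸ 1
    row = nth T [] i
    column : l + 1 + k ≡ c
    column = trans (+-assoc l 1 k) (+-suc-∸-∸1 l<c)
    i<length : i < length mu
    i<length = 0<nth⇒<length mu i (<-≤-trans (≤-<-trans z≤n l<c) c≤m)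
    k<length : k < length row
    k<length = subst (k <_) (sym (rowLength (suc i) 1≤j i<length))
      (subst (_≤ part mu (suc i) ∸ l) (m+n∸m≡n l (suc k))
        (∸-monoˡ-≤ l (subst (_≤ part mu (suc i)) (sym (+-suc-∸-∸1 l<c)) c≤m)))

  filling-ext : la ⊆ₚ mu → ∀ T T' → HasShape mu la T → HasShape mu la T' →
                (∀ j c → InShape mu la j c → entry la T j c ≡ entry la T' j c) → T ≡ T'
  filling-ext la⊆mu T T' (lengthT , rowLength) (lengthT' , rowLength') sameEntries =
    nth-ext [] T T' (trans lengthT (sym lengthT')) sameRow
    where
    sameRow : ∀ i → i < length T → nth T [] i ≡ nth T' [] i
    sameRow i i<length = nth-ext 0 row row' (trans lengthRow (sym lengthRow')) sameEntry
      where
      row = nth T [] i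
      row' = nth T' [] i
      l = part la (suc i)
      j≤ = subst (i <_) lengthT i<length
      lengthRow = rowLength (suc i) (s≤s z≤n) j≤
      lengthRow' = rowLength' (suc i) (s≤s z≤n) j≤
      sameEntry : ∀ k → k < length row → nth row 0 k ≡ nth row' 0 k
      sameEntry k k<length =
        subst (λ k' → nth row 0 k' ≡ nth row' 0 k') (cong (_∸ 1) (m+n∸m≡n l (suc k)))
          (sameEntries (suc i) (l + suc k) (s≤s z≤n , m<m+n l z<s , inRow))
        where
        inRow : l + suc k ≤ part mu (suc i)
        inRow = subst (l + suc k ≤_) (m+[n∸m]≡n (la⊆mu (suc i)))
                  (+-monoʳ-≤ l (subst (k <_) lengthRow k<length))

  private
    rowIncreasingOn : ∀ T → (∀ j c c' → InShape mu la j c → InShape mu la j c' → c < c' →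
                               entry la T j c < entry la T j c') →
                    ∀ {j} → 1 ≤ j → ∀ {c c'} → part la j < c → c < c' → c' ≤ part mu j →
                    entry la T j c < entry la T j c'
    rowIncreasingOn T T-rows {j} 1≤j {c} {c'} l<c c<c' c'≤m =
      T-rows j c c' (1≤j , l<c , ≤-trans (<⇒≤ c<c') c'≤m) (1≤j , <-trans l<c c<c' , c'≤m) c<c'

  entry-gap : ∀ T → IsIncreasingTableau mu la T → ∀ {j c c'} →
              InShape mu la j c → InShape mu la j c' → c ≤ c' →
              entry la T j c + c' ≤ entry la T j c' + c
  entry-gap T (_ , _ , T-rows , _) {j} (1≤j , l<c , _) (_ , _ , c'≤m) c≤c' =
    increasing-gap (entry la T j) (rowIncreasingOn T T-rows 1≤j) l<c (≤⇒≤′ c≤c') c'≤m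

  column≤entry+part : ∀ T → IsIncreasingTableau mu la T → ∀ {j c} →
                      InShape mu la j c → c ≤ entry la T j c + part la j
  column≤entry+part T (_ , T-positive , T-rows , _) {j} (1≤j , l<c , c≤m) =
    increasing-lowerBound (entry la T j) (rowIncreasingOn T T-rows 1≤j)
      (λ l<c' c'≤m → T-positive j _ (1≤j , l<c' , c'≤m)) l<c c≤m

  SSYTbar⇒part₁<entry+column : ∀ S → SSYTbar mu la S → ∀ {j c} →
                               InShape mu la j c → suc (part la 1) < entry la S j c + c
  SSYTbar⇒part₁<entry+column S (_ , S-bounds) {j} {c} box@(_ , l<c , _) = begin-strict
    suc K            ≡⟨ +-comm 1 K ⟩
    K + 1            ≤⟨ m≤n+m∸n (K + 1) l ⟩
    l + (K + 1 ∸ l)  ≤⟨ +-monoʳ-≤ l (proj₁ (S-bounds j c box)) ⟩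
    l + s            <⟨ +-monoˡ-< s l<c ⟩
    c + s            ≡⟨ +-comm c s ⟩
    s + c            ∎
    where
    open ≤-Reasoning
    K = part la 1
    l = part la j
    s = entry la S j c

  Shifted : Filling → Filling → Set
  Shifted T S = ∀ j c → InShape mu la j c → Shift (part la 1) c (entry la T j c) (entry la S j c)

  Fc⇒SSYTbar : IsPartition la → ∀ T S → Fc mu la T → HasShape mu la S → Shifted T S →
               SSYTbar mu la S
  Fc⇒SSYTbar la-partition T S (T-increasing@(_ , _ , _ , T-columns) , T-bounded) S-shape shifted =
    (S-shape , S-positive , S-rows , S-columns) , S-bounds
    where
    S-bounds : ∀ j c → InShape mu la j c →
               (part la 1 + 1 ∸ part la j ≤ entry la S j c) × (entry la S j c ≤ part la 1)
    S-bounds j c box =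
      shift-lowerBound (shifted j c box) (column≤entry+part T T-increasing box) ,
      shift-<c⇒≤K (shifted j c box) (T-bounded j c box)
    S-positive : ∀ j c → InShape mu la j c → 1 ≤ entry la S j c
    S-positive j c box =
      ≤-trans (m<n⇒0<n∸m (≤-<-trans (part≤part₁ la-partition j) (m<m+n (part la 1) z<s)))
              (proj₁ (S-bounds j c box))
    S-rows : ∀ j c c' → InShape mu la j c → InShape mu la j c' → c < c' →
             entry la S j c ≤ entry la S j c'
    S-rows j c c' box box' c<c' =
      shift-monotone (shifted j c box) (shifted j c' box')
        (entry-gap T T-increasing box box' (<⇒≤ c<c'))
    S-columns : ∀ j j' c → InShape mu la j c → InShape mu la j' c → j < j' →
                entry la S j c < entry la S j' c
    S-columns j j' c box box' j<j' =
      +-cancelʳ-< c _ _ (shift-preserves-< (shifted j c box) (shifted j' c box')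
                                           (T-columns j j' c box box' j<j'))

  SSYTbar⇒Fc : ∀ T S → SSYTbar mu la S → HasShape mu la T → Shifted T S → Fc mu la T
  SSYTbar⇒Fc T S S-SSYTbar@((_ , _ , S-rows , S-columns) , S-bounds) T-shape shifted =
    (T-shape , T-positive , T-rows , T-columns) , T-bounded
    where
    T-positive : ∀ j c → InShape mu la j c → 1 ≤ entry la T j c
    T-positive j c box =
      shift-positive (shifted j c box) (SSYTbar⇒part₁<entry+column S S-SSYTbar box)
    T-rows : ∀ j c c' → InShape mu la j c → InShape mu la j c' → c < c' →
             entry la T j c < entry la T j c'
    T-rows j c c' box box' c<c' =
      shift-reflects-< (shifted j c box) (shifted j c' box')
        (+-mono-≤-< (S-rows j c c' box box' c<c') c<c')
    T-columns : ∀ j j' c → InShape mu la j c → InShape mu la j' c → j < j' →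
                entry la T j c < entry la T j' c
    T-columns j j' c box box' j<j' =
      shift-reflects-< (shifted j c box) (shifted j' c box')
        (+-monoˡ-< c (S-columns j j' c box box' j<j'))
    T-bounded : ∀ j c → InShape mu la j c → entry la T j c < c
    T-bounded j c box = shift-≤K⇒<c (shifted j c box) (proj₂ (S-bounds j c box))

  HasShape-phi : ∀ T → HasShape mu la T → HasShape mu la (phi la T)
  HasShape-phi T T-shape =
    subst (HasShape mu la) (sym (phi≡mapFilling la T)) (HasShape-mapFilling _ T T-shape)

  entry-phi : ∀ T {j c} → HasShape mu la T → InShape mu la j c →
              entry la (phi la T) j c ≡ phiEntry (part la 1) c (entry la T j c)
  entry-phi T {j} {c} T-shape box =
    trans (cong (λ P → entry la P j c) (phi≡mapFilling la T)) (entry-mapFilling _ T T-shape box)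

  Fc⇒Shifted-phi : IsPartition la → ∀ T → Fc mu la T → Shifted T (phi la T)
  Fc⇒Shifted-phi la-partition T (T-increasing@(T-shape , _) , _) j c box =
    subst (Shift (part la 1) c e) (sym (entry-phi T T-shape box)) (shift-phiEntry c≤e+K+1)
    where
    e = entry la T j c
    c≤e+K+1 : c ≤ e + suc (part la 1)
    c≤e+K+1 = ≤-trans (column≤entry+part T T-increasing box)
                      (+-monoʳ-≤ e (m≤n⇒m≤1+n (part≤part₁ la-partition j)))

  SSYTbar⇒Shifted-psi : ∀ S → SSYTbar mu la S → Shifted (psi la S) S
  SSYTbar⇒Shifted-psi S S-SSYTbar@((S-shape , _) , _) j c box =
    subst (λ e → Shift (part la 1) c e (entry la S j c)) (sym (entry-mapFilling _ S S-shape box))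
      (shift-psiEntry (<⇒≤ (SSYTbar⇒part₁<entry+column S S-SSYTbar box)))

  Shifted⇒phi≡ : la ⊆ₚ mu → ∀ T S → HasShape mu la T → HasShape mu la S → Shifted T S →
                 phi la T ≡ S
  Shifted⇒phi≡ la⊆mu T S T-shape S-shape shifted =
    filling-ext la⊆mu (phi la T) S (HasShape-phi T T-shape) S-shape
      (λ j c box → trans (entry-phi T T-shape box) (phiEntry-shift (shifted j c box)))

  Shifted-injective : la ⊆ₚ mu → ∀ T T' S → HasShape mu la T → HasShape mu la T' →
                      Shifted T S → Shifted T' S → T ≡ T'
  Shifted-injective la⊆mu T T' S T-shape T'-shape shifted shifted' =
    filling-ext la⊆mu T T' T-shape T'-shape
      (λ j c box → shift-injective (shifted j c box) (shifted' j c box))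

proposition3p19 : (la mu : List ℕ) → IsPartition la → IsPartition mu → la ⊆ₚ mu →
    ((T : Filling) → Fc mu la T → SSYTbar mu la (phi la T)) ×
    ((T T' : Filling) → Fc mu la T → Fc mu la T' → phi la T ≡ phi la T' → T ≡ T') ×
    ((S : Filling) → SSYTbar mu la S → ∃ λ T → Fc mu la T × phi la T ≡ S)
proposition3p19 la mu la-partition _ la⊆mu = phi-into , phi-injective , phi-surjective
  where
  open SkewShape mu la

  phi-into : (T : Filling) → Fc mu la T → SSYTbar mu la (phi la T)
  phi-into T T-Fc@((T-shape , _) , _) =
    Fc⇒SSYTbar la-partition T (phi la T) T-Fc (HasShape-phi T T-shape)
      (Fc⇒Shifted-phi la-partition T T-Fc)

  phi-injective : (T T' : Filling) → Fc mu la T → Fc mu la T' → phi la T ≡ phi la T' → T ≡ T'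
  phi-injective T T' T-Fc@((T-shape , _) , _) T'-Fc@((T'-shape , _) , _) phiT≡phiT' =
    Shifted-injective la⊆mu T T' (phi la T) T-shape T'-shape (Fc⇒Shifted-phi la-partition T T-Fc)
      (subst (Shifted T') (sym phiT≡phiT') (Fc⇒Shifted-phi la-partition T' T'-Fc))

  phi-surjective : (S : Filling) → SSYTbar mu la S → ∃ λ T → Fc mu la T × phi la T ≡ S
  phi-surjective S S-SSYTbar@((S-shape , _) , _) =
    psi la S , SSYTbar⇒Fc (psi la S) S S-SSYTbar psi-shape shifted ,
    Shifted⇒phi≡ la⊆mu (psi la S) S psi-shape S-shape shifted
    where
    psi-shape = HasShape-mapFilling _ S S-shape
    shifted = SSYTbar⇒Shifted-psi S S-SSYTbar
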